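{- (i) Let $m>1$ be an odd integer and $a\in\{0,1,2,\ldots\}$. If $r$ is a positive integer such that $2r$ is a quadratic residue modulo $m$, then there are infinitely many positive integers $n$ not of the form $n=(2^ap-r)/m^2+T_x$ with $p$ a prime and $x\in\mathbb{Z}$. Consequently, the set $S^{(a)}_{m^2}=\{n>m^2:\ \gcd(m^2,n)=1 \text{ and } n\neq 2^ap+m^2T_x \text{ for every prime } p \text{ and every } x\in\mathbb{Z}\}$ is infinite. (ii) Let $m=2^{\alpha}m_0$ be a positive even integer with $\alpha,m_0$ positive integers and $m_0$ odd. If $r$ is a positive integer which is a quadratic residue modulo $m_0$ and satisfies $r\equiv 2^{\alpha}+1\pmod{2^{\min\{\alpha+1,3\}}}$, then there are infinitely many positive integers $n$ not of the form $n=(p-r)/(2m^2)+T_x$ with $p$ a prime and $x\in\mathbb{Z}$. Consequently, the set $S_{2m^2}=\{n>2m^2:\ \gcd(2m^2,n)=1 \text{ and } n\neq p+2m^2T_x \text{ for every prime } p \text{ and every } x\in\mathbb{Z}\}$ is infinite.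
   Context: For $x\in\mathbb{Z}$, $T_x=x(x+1)/2$ denotes the $x$-th triangular number. An integer $r$ is a quadratic residue modulo $m$ if $r\equiv y^2\pmod m$ for some integer $y$ coprime to $m$ (for $m_0=1$ every integer counts as a quadratic residue). -}

module Defs where

open import Data.Nat as ℕ using (ℕ; _<_; _^_; _⊓_)
open import Data.Nat.Coprimality using (Coprime)
open import Data.Nat.Divisibility as ℕD using ()
open import Data.Nat.Primality using (Prime)
open import Data.Integer as ℤ using (ℤ; +_; ∣_∣)
open import Data.Integer.DivMod using (_/ℕ_)
open import Data.Integer.Divisibility as ℤD using ()
open import Data.Product using (Σ; ∃; _×_)
open import Relation.Nullary using (¬_)
open import Relation.Binary.PropositionalEquality using (_≡_; _≢_)

-- Triangular number T_x = x(x+1)/2 for x ∈ ℤ (x(x+1) is even, so the division is exact).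
T : ℤ → ℤ
T x = (x ℤ.* (x ℤ.+ + 1)) /ℕ 2

QuadRes : ℕ → ℤ → Set
QuadRes m r = ∃ λ (y : ℤ) → Coprime ∣ y ∣ m × (+ m) ℤD.∣ (r ℤ.- y ℤ.* y)

Odd : ℕ → Set
Odd k = ¬ (2 ℕD.∣ k)

InfinitelyMany : (ℕ → Set) → Set
InfinitelyMany P = ∀ (N : ℕ) → ∃ λ n → N < n × P n

-- n = (c·p - r)/M + T_x  (as rationals)  ⇔  M·n + r = c·p + M·T_x  (in ℤ).
OfForm : (c M r : ℕ) → ℕ → Set
OfForm c M r n = ∃ λ (p : ℕ) → Prime p × ∃ λ (x : ℤ) →
  + (M ℕ.* n) ℤ.+ + r ≡ + (c ℕ.* p) ℤ.+ + M ℤ.* T x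

Rep : (c M : ℕ) → ℕ → Set
Rep c M n = ∃ λ (p : ℕ) → Prime p × ∃ λ (x : ℤ) → + n ≡ + (c ℕ.* p) ℤ.+ + M ℤ.* T x

InS : (a M : ℕ) → ℕ → Set
InS a M n = M < n × Coprime M n × ¬ Rep (2 ^ a) M n

Part1 : Set
Part1 = ∀ (m : ℕ) → 1 < m → Odd m → (a r : ℕ) → 0 < r → QuadRes m (+ (2 ℕ.* r)) →
  InfinitelyMany (λ n → 0 < n × ¬ OfForm (2 ^ a) (m ℕ.* m) r n)
  × InfinitelyMany (InS a (m ℕ.* m))

Part2 : Set
Part2 = ∀ (α m₀ : ℕ) → 0 < α → 0 < m₀ → Odd m₀ →
  let m = 2 ^ α ℕ.* m₀ in
  (r : ℕ) → 0 < r → QuadRes m₀ (+ r) →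
  (+ (2 ^ ((α ℕ.+ 1) ⊓ 3))) ℤD.∣ (+ r ℤ.- + (2 ^ α ℕ.+ 1)) →
  InfinitelyMany (λ n → 0 < n × ¬ OfForm 1 (2 ℕ.* (m ℕ.* m)) r n)
  × InfinitelyMany (InS 0 (2 ℕ.* (m ℕ.* m)))

-- (i) If 2ᵃp + m²Tₓ = m²n + r, multiplying by 8 and adding m² gives
-- z² − m²(2x+1)² = 2ᵃ⁺³p for z² = 8r + m² + 8m²n.  Since 2r is a quadratic residue modulo
-- the odd m, Hensel lifting and the Chinese remainder theorem give an odd z₀ with
-- z₀² ≡ 8r + m² (mod K = 8m²), so every z ≡ z₀ (mod K) yields such an n.  As z and
-- m(2x+1) are odd, the factorisation forces z = 1 + 2ᵃ⁺¹p or z = p + 2ᵃ⁺¹; further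
-- congruences modulo K + 1 and K(K+1) + 1 make both impossible for all large z.
-- (ii) Likewise with 2m² = 8h²: z² = r + h² + 8h²n gives z² − h²(2x+1)² = p, forcing
-- 2z = p + 1, which 2z ≡ 1 (mod 2m² + 1) rules out.  Here r + h² is a square modulo 2m²:
-- modulo m₀² by Hensel lifting, modulo the power of 2 because r + h² ≡ 1 (mod 8) (or
-- r ≡ 3 (mod 4) when α = 1).  Finally n ↦ m²n + r, resp. 2m²n + r, maps excluded n into S.
module Submission where

open import Data.Integer.Base as ℤ using (ℤ; +_; -[1+_]; ∣_∣; _+_; _-_; _*_; -_; +<+)
import Data.Integer.Coprimality as ℤCoprime
import Data.Integer.Divisibility as ℤD
open import Data.Integer.Divisibility.Signed
  using (_∣_; divides; ∣ᵤ⇒∣; ∣⇒∣ᵤ; ∣-trans; ∣m∣n⇒∣m+n; ∣m∣n⇒∣m-n; ∣m⇒∣m*n; ∣n⇒∣m*n)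
open import Data.Integer.DivMod using (_/ℕ_; _%ℕ_; n%ℕd<d; a≡a%ℕn+[a/ℕn]*n)
import Data.Integer.Properties as ℤₚ
open import Data.Integer.Tactic.RingSolver using (solve-∀)
open import Data.Nat.Base as ℕ using (ℕ; zero; suc; _^_; _⊓_; NonZero; z≤n; s≤s)
open import Data.Nat.Coprimality as Coprimality
  using (Coprime; coprime-Bézout; coprime-divisor; coprime-+; 1-coprimeTo)
import Data.Nat.Divisibility as ℕD
open import Data.Nat.GCD using (module Bézout)
open import Data.Nat.Primality using (Prime; prime⇒irreducible; euclidsLemma; prime[2]; ¬prime[0])
import Data.Nat.Properties as ℕₚ
import Data.Nat.Tactic.RingSolver as ℕSolver
open import Data.Product.Base using (∃; ∃₂; _×_; _,_)
open import Data.Sum.Base using (_⊎_; inj₁; inj₂; [_,_]′)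
open import Function.Base using (id)
open import Relation.Binary.PropositionalEquality
open import Relation.Nullary using (¬_; contradiction)

open import Defs

open ≡-Reasoning

-- Parity and triangular numbers

data Parity (i : ℤ) : Set where
  even : ∀ t → i ≡ + 2 * t → Parity i
  odd  : ∀ t → i ≡ + 2 * t + + 1 → Parity i

i≡2[i/ℕ2]+i%ℕ2 : ∀ i → i ≡ + 2 * (i /ℕ 2) + + (i %ℕ 2)
i≡2[i/ℕ2]+i%ℕ2 i = trans (a≡a%ℕn+[a/ℕn]*n i 2) (r+q*2≡2q+r (+ (i %ℕ 2)) (i /ℕ 2))
  where r+q*2≡2q+r : ∀ r q → r + q * + 2 ≡ + 2 * q + r
        r+q*2≡2q+r = solve-∀

parity : ∀ i → Parity i
parity i with i %ℕ 2 | i /ℕ 2 | n%ℕd<d i 2 | i≡2[i/ℕ2]+i%ℕ2 i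
... | 0           | q | _              | i≡ = even q (trans i≡ (ℤₚ.+-identityʳ (+ 2 * q)))
... | 1           | q | _              | i≡ = odd q i≡
... | suc (suc _) | _ | s≤s (s≤s ()) | _

even≢odd : ∀ s t → + 2 * s ≢ + 2 * t + + 1
even≢odd s t 2s≡2t+1 = contradiction (ℕₚ.m*n≡1⇒m≡1 2 ∣ s - t ∣ 2∣s-t∣≡1) λ ()
  where
  2[s-t]≡1 : + 2 * (s - t) ≡ + 1
  2[s-t]≡1 = begin
    + 2 * (s - t)             ≡⟨ distrib s t ⟩
    + 2 * s - + 2 * t         ≡⟨ cong (_- + 2 * t) 2s≡2t+1 ⟩
    + 2 * t + + 1 - + 2 * t   ≡⟨ cancel t ⟩
    + 1                       ∎
    where
    distrib : ∀ s t → + 2 * (s - t) ≡ + 2 * s - + 2 * t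
    distrib = solve-∀
    cancel : ∀ t → + 2 * t + + 1 - + 2 * t ≡ + 1
    cancel = solve-∀
  2∣s-t∣≡1 : 2 ℕ.* ∣ s - t ∣ ≡ 1
  2∣s-t∣≡1 = trans (sym (ℤₚ.abs-* (+ 2) (s - t))) (cong ∣_∣ 2[s-t]≡1)

odd⇒2t+1 : ∀ {i} → Odd ∣ i ∣ → ∃ λ t → i ≡ + 2 * t + + 1
odd⇒2t+1 {i} i-odd with parity i
... | even t refl = contradiction (∣⇒∣ᵤ (divides t (ℤₚ.*-comm (+ 2) t))) i-odd
... | odd t refl  = t , refl

2t+1-odd : ∀ t → Odd ∣ + 2 * t + + 1 ∣
2t+1-odd t 2∣2t+1 = let divides q 2t+1≡q*2 = ∣ᵤ⇒∣ {+ 2} 2∣2t+1 in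
  even≢odd q t (sym (trans 2t+1≡q*2 (ℤₚ.*-comm q (+ 2))))

odd-* : ∀ {m n} → Odd m → Odd n → Odd (m ℕ.* n)
odd-* m-odd n-odd 2∣mn with euclidsLemma _ _ prime[2] 2∣mn
... | inj₁ 2∣m = m-odd 2∣m
... | inj₂ 2∣n = n-odd 2∣n

even⇒[i/ℕ2]*2≡i : ∀ {i} k → i ≡ + 2 * k → (i /ℕ 2) * + 2 ≡ i
even⇒[i/ℕ2]*2≡i {i} k i≡2k with i %ℕ 2 | i /ℕ 2 | n%ℕd<d i 2 | i≡2[i/ℕ2]+i%ℕ2 i
... | 0           | q | _              | i≡ = trans (q*2≡2q+0 q) (sym i≡)
  where q*2≡2q+0 : ∀ q → q * + 2 ≡ + 2 * q + + 0
        q*2≡2q+0 = solve-∀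
... | 1           | q | _              | i≡ = contradiction (trans (sym i≡2k) i≡) (even≢odd k q)
... | suc (suc _) | _ | s≤s (s≤s ()) | _

T*2≡x*[x+1] : ∀ x → T x * + 2 ≡ x * (x + + 1)
T*2≡x*[x+1] x with parity x
... | even t refl = even⇒[i/ℕ2]*2≡i (t * (+ 2 * t + + 1)) (even-case t)
  where even-case : ∀ t → + 2 * t * (+ 2 * t + + 1) ≡ + 2 * (t * (+ 2 * t + + 1))
        even-case = solve-∀
... | odd t refl  = even⇒[i/ℕ2]*2≡i ((+ 2 * t + + 1) * (t + + 1)) (odd-case t)
  where odd-case : ∀ t → (+ 2 * t + + 1) * (+ 2 * t + + 1 + + 1) ≡ + 2 * ((+ 2 * t + + 1) * (t + + 1))
        odd-case = solve-∀

-- Congruences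

infix 4 _≡_mod_

-- A record rather than a synonym for + d ∣ x - y, so that x, y and d can be inferred.
record _≡_mod_ (x y : ℤ) (d : ℕ) : Set where
  constructor congruent
  field divides-difference : + d ∣ x - y

mod-sym : ∀ {x y d} → x ≡ y mod d → y ≡ x mod d
mod-sym {x} {y} {d} (congruent (divides q x-y≡qd)) = congruent (divides (- q) (begin
  y - x       ≡⟨ swap x y ⟩
  - (x - y)   ≡⟨ cong -_ x-y≡qd ⟩
  - (q * + d) ≡⟨ ℤₚ.neg-distribˡ-* q (+ d) ⟩
  - q * + d   ∎))
  where swap : ∀ x y → y - x ≡ - (x - y)
        swap = solve-∀

mod-trans : ∀ {x y w d} → x ≡ y mod d → y ≡ w mod d → x ≡ w mod d
mod-trans {x} {y} {w} (congruent d∣x-y) (congruent d∣y-w) =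
  congruent (subst (_ ∣_) (telescope x y w) (∣m∣n⇒∣m+n d∣x-y d∣y-w))
  where telescope : ∀ x y w → (x - y) + (y - w) ≡ x - w
        telescope = solve-∀

mod-weaken : ∀ {x y d e} → d ℕD.∣ e → x ≡ y mod e → x ≡ y mod d
mod-weaken d∣e (congruent e∣x-y) = congruent (∣-trans (∣ᵤ⇒∣ d∣e) e∣x-y)

mod-+ˡ : ∀ {x y d} a → x ≡ y mod d → a + x ≡ a + y mod d
mod-+ˡ {x} {y} a (congruent d∣x-y) = congruent (subst (_ ∣_) (shift a x y) d∣x-y)
  where shift : ∀ a x y → x - y ≡ a + x - (a + y)
        shift = solve-∀

mod-*ˡ : ∀ {x y d} a → x ≡ y mod d → a * x ≡ a * y mod d
mod-*ˡ {x} {y} a (congruent d∣x-y) = congruent (subst (_ ∣_) (distrib a x y) (∣n⇒∣m*n a d∣x-y))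
  where distrib : ∀ a x y → a * (x - y) ≡ a * x - a * y
        distrib = solve-∀

mod-square : ∀ {x y d} → x ≡ y mod d → x * x ≡ y * y mod d
mod-square {x} {y} (congruent d∣x-y) =
  congruent (subst (_ ∣_) (difference-of-squares x y) (∣m⇒∣m*n (x + y) d∣x-y))
  where difference-of-squares : ∀ x y → (x - y) * (x + y) ≡ x * x - y * y
        difference-of-squares = solve-∀

mod-combine : ∀ {x y P Q} → Coprime P Q → x ≡ y mod P → x ≡ y mod Q → x ≡ y mod P ℕ.* Q
mod-combine {x} {y} {P} {Q} P⊥Q (congruent (divides k x-y≡kP)) (congruent Q∣x-y) =
  let divides k′ k≡k′Q = ∣ᵤ⇒∣ {+ Q} {k} (ℤCoprime.coprime-divisor (+ Q) (+ P) k (Coprimality.sym P⊥Q) Q∣Pk)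
  in congruent (divides k′ (begin
    x - y             ≡⟨ x-y≡kP ⟩
    k * + P           ≡⟨ cong (_* + P) k≡k′Q ⟩
    k′ * + Q * + P    ≡⟨ reassoc k′ (+ Q) (+ P) ⟩
    k′ * (+ P * + Q)  ≡⟨ cong (k′ *_) (ℤₚ.pos-* P Q) ⟨
    k′ * + (P ℕ.* Q)  ∎))
  where
  Q∣Pk : + Q ℤD.∣ + P * k
  Q∣Pk = ∣⇒∣ᵤ {+ Q} (subst (+ Q ∣_) (trans x-y≡kP (ℤₚ.*-comm k (+ P))) Q∣x-y)
  reassoc : ∀ a b c → a * b * c ≡ a * (c * b)
  reassoc = solve-∀

+-mod⇒∣ : ∀ {a b d} → + (a ℕ.+ b) ≡ + b mod d → d ℕD.∣ a
+-mod⇒∣ {a} {b} {d} (congruent d∣a+b-b) = ∣⇒∣ᵤ {+ d} (subst (_ ∣_) (a+b-b≡a (+ a) (+ b)) d∣a+b-b)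
  where a+b-b≡a : ∀ a b → a + b - b ≡ a
        a+b-b≡a = solve-∀

odd-resp-mod : ∀ {x y d} → 2 ℕD.∣ d → x ≡ y mod d → Odd ∣ y ∣ → Odd ∣ x ∣
odd-resp-mod {x} {y} 2∣d (congruent d∣x-y) y-odd 2∣x =
  y-odd (∣⇒∣ᵤ {+ 2} (subst (+ 2 ∣_) (x-[x-y]≡y x y)
    (∣m∣n⇒∣m-n (∣ᵤ⇒∣ {+ 2} {x} 2∣x) (∣-trans (∣ᵤ⇒∣ 2∣d) d∣x-y))))
  where x-[x-y]≡y : ∀ x y → x - (x - y) ≡ y
        x-[x-y]≡y = solve-∀

odd²≡1-mod-8 : ∀ {i} → Odd ∣ i ∣ → i * i ≡ + 1 mod 8
odd²≡1-mod-8 {i} i-odd = let t , i≡2t+1 = odd⇒2t+1 {i} i-odd in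
  subst (λ j → j * j ≡ + 1 mod 8) (sym i≡2t+1) (square-of-2t+1 t)
  where
  square-of-2t+1 : ∀ t → (+ 2 * t + + 1) * (+ 2 * t + + 1) ≡ + 1 mod 8
  square-of-2t+1 t with parity t
  ... | even u refl = congruent (divides (+ 2 * u * u + u) (even-case u))
    where even-case : ∀ u → (+ 2 * (+ 2 * u) + + 1) * (+ 2 * (+ 2 * u) + + 1) - + 1 ≡ (+ 2 * u * u + u) * + 8
          even-case = solve-∀
  ... | odd u refl  = congruent (divides (+ 2 * u * u + + 3 * u + + 1) (odd-case u))
    where odd-case : ∀ u → (+ 2 * (+ 2 * u + + 1) + + 1) * (+ 2 * (+ 2 * u + + 1) + + 1) - + 1
                           ≡ (+ 2 * u * u + + 3 * u + + 1) * + 8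
          odd-case = solve-∀

-- Coprimality and the Chinese remainder theorem

coprime-* : ∀ {a b c} → Coprime a c → Coprime b c → Coprime (a ℕ.* b) c
coprime-* a⊥c b⊥c {i} (i∣ab , i∣c) = b⊥c (coprime-divisor i⊥a i∣ab , i∣c)
  where i⊥a : Coprime i _
        i⊥a (j∣i , j∣a) = a⊥c (j∣a , ℕD.∣-trans j∣i i∣c)

n⊥1+n : ∀ n → Coprime n (suc n)
n⊥1+n n = Coprimality.sym (subst (λ k → Coprime k n) (ℕₚ.+-comm n 1) (coprime-+ (1-coprimeTo n)))

2⊥odd : ∀ {d} → Odd d → Coprime 2 d
2⊥odd d-odd (i∣2 , i∣d) with prime⇒irreducible prime[2] i∣2
... | inj₁ i≡1  = i≡1
... | inj₂ refl = contradiction i∣d d-odd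

2^k⊥odd : ∀ k {d} → Odd d → Coprime (2 ^ k) d
2^k⊥odd zero    d-odd = 1-coprimeTo _
2^k⊥odd (suc k) d-odd = coprime-* (2⊥odd d-odd) (2^k⊥odd k d-odd)

quadRes⇒coprime : ∀ {m R} → QuadRes m R → Coprime m ∣ R ∣
quadRes⇒coprime {m} {R} (y , y⊥m , m∣R-y²) {i} (i∣m , i∣R) = y⊥m (i∣y , i∣m)
  where
  i∣y² : + i ∣ y * y
  i∣y² = subst (+ i ∣_) (R-[R-y²]≡y² R y)
    (∣m∣n⇒∣m-n (∣ᵤ⇒∣ {+ i} {R} i∣R) (∣-trans (∣ᵤ⇒∣ {+ i} {+ m} i∣m) (∣ᵤ⇒∣ m∣R-y²)))
    where R-[R-y²]≡y² : ∀ R y → R - (R - y * y) ≡ y * y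
          R-[R-y²]≡y² = solve-∀
  i⊥y : Coprime i ∣ y ∣
  i⊥y (j∣i , j∣y) = y⊥m (j∣y , ℕD.∣-trans j∣i i∣m)
  i∣y : i ℕD.∣ ∣ y ∣
  i∣y = coprime-divisor i⊥y (subst (i ℕD.∣_) (ℤₚ.abs-* y y) (∣⇒∣ᵤ i∣y²))

∣prime⇒≡ : ∀ {q p} → Prime p → 1 ℕ.< q → q ℕD.∣ p → q ≡ p
∣prime⇒≡ p-prime 1<q q∣p with prime⇒irreducible p-prime q∣p
... | inj₁ refl = contradiction 1<q (ℕₚ.<-irrefl refl)
... | inj₂ q≡p  = q≡p

bézout : ∀ {P Q} → Coprime P Q → ∃₂ λ u v → u * + P + v * + Q ≡ + 1
bézout {P} {Q} P⊥Q with coprime-Bézout P⊥Q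
... | Bézout.+- x y 1+yQ≡xP = + x , - + y , (begin
  + x * + P + - + y * + Q          ≡⟨ cong (_+ - + y * + Q) (lift x y 1+yQ≡xP) ⟨
  + 1 + + y * + Q + - + y * + Q    ≡⟨ cancel (+ y) (+ Q) ⟩
  + 1                              ∎)
  where
  lift : ∀ x y → 1 ℕ.+ y ℕ.* Q ≡ x ℕ.* P → + 1 + + y * + Q ≡ + x * + P
  lift x y eq = trans (cong (λ t → + 1 + t) (sym (ℤₚ.pos-* y Q))) (trans (cong +_ eq) (ℤₚ.pos-* x P))
  cancel : ∀ y Q → + 1 + y * Q + - y * Q ≡ + 1
  cancel = solve-∀
... | Bézout.-+ x y 1+xP≡yQ = - + x , + y , (begin
  - + x * + P + + y * + Q          ≡⟨ cong (λ t → - + x * + P + t) (lift x y 1+xP≡yQ) ⟨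
  - + x * + P + (+ 1 + + x * + P)  ≡⟨ cancel (+ x) (+ P) ⟩
  + 1                              ∎)
  where
  lift : ∀ x y → 1 ℕ.+ x ℕ.* P ≡ y ℕ.* Q → + 1 + + x * + P ≡ + y * + Q
  lift x y eq = trans (cong (λ t → + 1 + t) (sym (ℤₚ.pos-* x P))) (trans (cong +_ eq) (ℤₚ.pos-* y Q))
  cancel : ∀ x P → - x * P + (+ 1 + x * P) ≡ + 1
  cancel = solve-∀

crt : ∀ {P Q} → Coprime P Q → ∀ a b → ∃ λ z → z ≡ a mod P × z ≡ b mod Q
crt {P} {Q} P⊥Q a b = let u , v , uP+vQ≡1 = bézout P⊥Q in
  a * v * + Q + b * u * + P ,
  congruent (divides ((b - a) * u) (begin
    a * v * + Q + b * u * + P - a                       ≡⟨ split-P a b u v (+ P) (+ Q) ⟩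
    (b - a) * u * + P + a * (u * + P + v * + Q - + 1)   ≡⟨ vanish uP+vQ≡1 ((b - a) * u * + P) a ⟩
    (b - a) * u * + P                                   ∎)) ,
  congruent (divides ((a - b) * v) (begin
    a * v * + Q + b * u * + P - b                       ≡⟨ split-Q a b u v (+ P) (+ Q) ⟩
    (a - b) * v * + Q + b * (u * + P + v * + Q - + 1)   ≡⟨ vanish uP+vQ≡1 ((a - b) * v * + Q) b ⟩
    (a - b) * v * + Q                                   ∎))
  where
  split-P : ∀ a b u v P Q → a * v * Q + b * u * P - a ≡ (b - a) * u * P + a * (u * P + v * Q - + 1)
  split-P = solve-∀
  split-Q : ∀ a b u v P Q → a * v * Q + b * u * P - b ≡ (a - b) * v * Q + b * (u * P + v * Q - + 1)
  split-Q = solve-∀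
  vanish : ∀ {s} → s ≡ + 1 → ∀ X c → X + c * (s - + 1) ≡ X
  vanish refl X c = X+c*[1-1]≡X X c
    where X+c*[1-1]≡X : ∀ X c → X + c * (+ 1 - + 1) ≡ X
          X+c*[1-1]≡X = solve-∀

large-representative : ∀ {d} .{{_ : NonZero d}} a B → ∃ λ z → B ℕ.≤ z × + z ≡ a mod d
large-representative {d} (+ k) B =
  k ℕ.+ d ℕ.* (B ℕ.+ k) ,
  ℕₚ.≤-trans (ℕₚ.≤-trans (ℕₚ.m≤m+n B k) (ℕₚ.m≤n*m (B ℕ.+ k) d)) (ℕₚ.m≤n+m _ k) ,
  congruent (divides (+ (B ℕ.+ k)) (begin
    + k + + (d ℕ.* (B ℕ.+ k)) - + k   ≡⟨ a+b-a≡b (+ k) _ ⟩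
    + (d ℕ.* (B ℕ.+ k))               ≡⟨ cong +_ (ℕₚ.*-comm d (B ℕ.+ k)) ⟩
    + ((B ℕ.+ k) ℕ.* d)               ≡⟨ ℤₚ.pos-* (B ℕ.+ k) d ⟩
    + (B ℕ.+ k) * + d                 ∎))
  where a+b-a≡b : ∀ a b → a + b - a ≡ b
        a+b-a≡b = solve-∀
large-representative {d} -[1+ k ] B =
  d ℕ.* (B ℕ.+ suc k) ℕ.∸ suc k ,
  subst (ℕ._≤ d ℕ.* (B ℕ.+ suc k) ℕ.∸ suc k) (ℕₚ.m+n∸n≡m B (suc k)) (ℕₚ.∸-monoˡ-≤ (suc k) B+k≤d[B+k]) ,
  congruent (divides (+ (B ℕ.+ suc k)) (begin
    + (d ℕ.* (B ℕ.+ suc k) ℕ.∸ suc k ℕ.+ suc k)   ≡⟨ cong +_ (ℕₚ.m∸n+n≡m k≤d[B+k]) ⟩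
    + (d ℕ.* (B ℕ.+ suc k))                       ≡⟨ cong +_ (ℕₚ.*-comm d (B ℕ.+ suc k)) ⟩
    + ((B ℕ.+ suc k) ℕ.* d)                       ≡⟨ ℤₚ.pos-* (B ℕ.+ suc k) d ⟩
    + (B ℕ.+ suc k) * + d                         ∎))
  where
  B+k≤d[B+k] : B ℕ.+ suc k ℕ.≤ d ℕ.* (B ℕ.+ suc k)
  B+k≤d[B+k] = ℕₚ.m≤n*m (B ℕ.+ suc k) d
  k≤d[B+k] : suc k ℕ.≤ d ℕ.* (B ℕ.+ suc k)
  k≤d[B+k] = ℕₚ.≤-trans (ℕₚ.m≤n+m (suc k) B) B+k≤d[B+k]

quotient-large : ∀ {K c z} N .{{_ : NonZero K}} → c ℕ.+ K ℕ.* suc N ℕ.≤ z →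
                 + z * + z ≡ + c mod K → ∃ λ n → N ℕ.< n × z ℕ.* z ≡ c ℕ.+ K ℕ.* n
quotient-large {K} {c} {z} N bound (congruent K∣z²-c) = from-divisor (∣⇒∣ᵤ (subst (+ K ∣_) z²-c≡X K∣z²-c))
  where
  n≤n*n : ∀ n → n ℕ.≤ n ℕ.* n
  n≤n*n zero    = z≤n
  n≤n*n (suc n) = ℕₚ.m≤m*n (suc n) (suc n)
  c+KN≤z² : c ℕ.+ K ℕ.* suc N ℕ.≤ z ℕ.* z
  c+KN≤z² = ℕₚ.≤-trans bound (n≤n*n z)
  c≤z² : c ℕ.≤ z ℕ.* z
  c≤z² = ℕₚ.≤-trans (ℕₚ.m≤m+n c _) c+KN≤z²
  z²-c≡X : + z * + z - + c ≡ + (z ℕ.* z ℕ.∸ c)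
  z²-c≡X = trans (cong (_- + c) (sym (ℤₚ.pos-* z z))) (trans (ℤₚ.m-n≡m⊖n (z ℕ.* z) c) (ℤₚ.⊖-≥ c≤z²))
  from-divisor : K ℕD.∣ z ℕ.* z ℕ.∸ c → ∃ λ n → N ℕ.< n × z ℕ.* z ≡ c ℕ.+ K ℕ.* n
  from-divisor (ℕD.divides n X≡nK) = n , N<n , z²≡c+Kn
    where
    KN≤nK : suc N ℕ.* K ℕ.≤ n ℕ.* K
    KN≤nK = subst₂ ℕ._≤_ (ℕₚ.*-comm K (suc N)) X≡nK
      (subst (ℕ._≤ z ℕ.* z ℕ.∸ c) (ℕₚ.m+n∸m≡n c (K ℕ.* suc N)) (ℕₚ.∸-monoˡ-≤ c c+KN≤z²))
    N<n : N ℕ.< n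
    N<n = ℕₚ.*-cancelʳ-≤ (suc N) n K KN≤nK
    z²≡c+Kn : z ℕ.* z ≡ c ℕ.+ K ℕ.* n
    z²≡c+Kn = trans (sym (ℕₚ.m+[n∸m]≡n c≤z²)) (cong (c ℕ.+_) (trans X≡nK (ℕₚ.*-comm n K)))

-- Square roots

-- Newton's step: u inverts Y and ι inverts 2 modulo m.
hensel-lift : ∀ {m Y u v k ι R} → u * Y + v * m ≡ + 1 → + 2 * ι ≡ m + + 1 → R - Y * Y ≡ k * m →
              (Y + m * u * k * ι) * (Y + m * u * k * ι) - R
              ≡ (k - k * (m + + 1) * v + u * u * k * k * ι * ι) * (m * m)
hensel-lift {m} {Y} {u} {v} {k} {ι} {R} uY+vm≡1 2ι≡m+1 R-Y²≡km = begin
  (Y + m * u * k * ι) * (Y + m * u * k * ι) - R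
    ≡⟨ expand m Y u v k ι R ⟩
  Q * (m * m) - (R - Y * Y - k * m) + (m * k * (m + + 1) * (u * Y + v * m - + 1)
    + m * u * k * Y * (+ 2 * ι - (m + + 1)))
    ≡⟨ cong₂ (λ a b → Q * (m * m) - a + b) (ℤₚ.i≡j⇒i-j≡0 R-Y²≡km)
             (cong₂ (λ a b → m * k * (m + + 1) * (a - + 1) + m * u * k * Y * b) uY+vm≡1 (ℤₚ.i≡j⇒i-j≡0 2ι≡m+1)) ⟩
  Q * (m * m) - + 0 + (m * k * (m + + 1) * (+ 1 - + 1) + m * u * k * Y * + 0)
    ≡⟨ drop-zeros Q m k u Y ⟩
  Q * (m * m) ∎
  where
  Q = k - k * (m + + 1) * v + u * u * k * k * ι * ι
  expand : ∀ m Y u v k ι R → (Y + m * u * k * ι) * (Y + m * u * k * ι) - R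
         ≡ (k - k * (m + + 1) * v + u * u * k * k * ι * ι) * (m * m) - (R - Y * Y - k * m)
           + (m * k * (m + + 1) * (u * Y + v * m - + 1) + m * u * k * Y * (+ 2 * ι - (m + + 1)))
  expand = solve-∀
  drop-zeros : ∀ Q m k u Y → Q * (m * m) - + 0 + (m * k * (m + + 1) * (+ 1 - + 1) + m * u * k * Y * + 0)
                             ≡ Q * (m * m)
  drop-zeros = solve-∀

quadRes⇒square-mod-square : ∀ {m R} → Odd m → QuadRes m R → ∃ λ w → w * w ≡ R mod m ℕ.* m
quadRes⇒square-mod-square {m} {R} m-odd (y , y⊥m , m∣R-y²) =
  let u , v , uY+vm≡1 = bézout y⊥m
      divides k R-Y²≡km = ∣ᵤ⇒∣ {+ m} {R - Y * Y} (subst (λ s → + m ℤD.∣ R - s) (y*y≡∣y∣*∣y∣ y) m∣R-y²)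
      μ , m≡2μ+1 = odd⇒2t+1 {+ m} m-odd
      ι = μ + + 1
      Q = k - k * (+ m + + 1) * v + u * u * k * k * ι * ι
  in Y + + m * u * k * ι ,
     congruent (divides Q (trans (hensel-lift {+ m} {Y} {u} {v} {k} {ι} {R} uY+vm≡1 (2ι≡m+1 {μ} m≡2μ+1) R-Y²≡km)
                                 (cong (Q *_) (sym (ℤₚ.pos-* m m)))))
  where
  Y = + ∣ y ∣
  y*y≡∣y∣*∣y∣ : ∀ y → y * y ≡ + ∣ y ∣ * + ∣ y ∣
  y*y≡∣y∣*∣y∣ (+ _)    = refl
  y*y≡∣y∣*∣y∣ -[1+ _ ] = refl
  2ι≡m+1 : ∀ {μ} → + m ≡ + 2 * μ + + 1 → + 2 * (μ + + 1) ≡ + m + + 1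
  2ι≡m+1 {μ} m≡2μ+1 = trans (distrib μ) (cong (_+ + 1) (sym m≡2μ+1))
    where distrib : ∀ μ → + 2 * (μ + + 1) ≡ + 2 * μ + + 1 + + 1
          distrib = solve-∀

+2^[k+j]≡+2^k*+2^j : ∀ k j → + (2 ^ (k ℕ.+ j)) ≡ + (2 ^ k) * + (2 ^ j)
+2^[k+j]≡+2^k*+2^j k j = trans (cong +_ (ℕₚ.^-distribˡ-+-* 2 k j)) (ℤₚ.pos-* (2 ^ k) (2 ^ j))

shifted-root-mod-2^ : ∀ {c} f t j → (+ 2 * f + + 1) * (+ 2 * f + + 1) - c ≡ (+ 2 * t + + 1) * + (2 ^ (3 ℕ.+ j)) →
                      (+ 2 * f + + 1 + + 4 * + (2 ^ j)) * (+ 2 * f + + 1 + + 4 * + (2 ^ j)) ≡ c mod 2 ^ (4 ℕ.+ j)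
shifted-root-mod-2^ {c} f t j e²-c≡ = congruent (divides (t + f + + 1 + G) (begin
  (+ 2 * f + + 1 + + 4 * G) * (+ 2 * f + + 1 + + 4 * G) - c
    ≡⟨ expand f c G ⟩
  ((+ 2 * f + + 1) * (+ 2 * f + + 1) - c) + + 8 * G * (+ 2 * f + + 1) + + 16 * G * G
    ≡⟨ cong (λ a → a + + 8 * G * (+ 2 * f + + 1) + + 16 * G * G) e²-c≡ ⟩
  (+ 2 * t + + 1) * + (2 ^ (3 ℕ.+ j)) + + 8 * G * (+ 2 * f + + 1) + + 16 * G * G
    ≡⟨ cong (λ P → (+ 2 * t + + 1) * P + + 8 * G * (+ 2 * f + + 1) + + 16 * G * G) (+2^[k+j]≡+2^k*+2^j 3 j) ⟩
  (+ 2 * t + + 1) * (+ 8 * G) + + 8 * G * (+ 2 * f + + 1) + + 16 * G * G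
    ≡⟨ collect t f G ⟩
  (t + f + + 1 + G) * (+ 16 * G)
    ≡⟨ cong ((t + f + + 1 + G) *_) (+2^[k+j]≡+2^k*+2^j 4 j) ⟨
  (t + f + + 1 + G) * + (2 ^ (4 ℕ.+ j)) ∎))
  where
  G = + (2 ^ j)
  expand : ∀ f c G → (+ 2 * f + + 1 + + 4 * G) * (+ 2 * f + + 1 + + 4 * G) - c
           ≡ ((+ 2 * f + + 1) * (+ 2 * f + + 1) - c) + + 8 * G * (+ 2 * f + + 1) + + 16 * G * G
  expand = solve-∀
  collect : ∀ t f G → (+ 2 * t + + 1) * (+ 8 * G) + + 8 * G * (+ 2 * f + + 1) + + 16 * G * G
            ≡ (t + f + + 1 + G) * (+ 16 * G)
  collect = solve-∀

-- If e is odd and e² ≡ c (mod 2³⁺ʲ), then e or e + 2²⁺ʲ is a square root of c modulo 2⁴⁺ʲ.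
1-mod-8⇒odd-square-mod-2^ : ∀ {c} → c ≡ + 1 mod 8 → ∀ j → ∃ λ e → Odd ∣ e ∣ × e * e ≡ c mod 2 ^ (3 ℕ.+ j)
1-mod-8⇒odd-square-mod-2^ {c} c≡1 zero = + 1 , 2t+1-odd (+ 0) , mod-sym c≡1
1-mod-8⇒odd-square-mod-2^ {c} c≡1 (suc j) with 1-mod-8⇒odd-square-mod-2^ c≡1 j
... | e , e-odd , congruent (divides D e²-c≡D2³⁺ʲ) with parity D | odd⇒2t+1 {e} e-odd
...   | even t refl | _ = e , e-odd , congruent (divides t (begin
  e * e - c                       ≡⟨ e²-c≡D2³⁺ʲ ⟩
  + 2 * t * + (2 ^ (3 ℕ.+ j))     ≡⟨ reassoc t (+ (2 ^ (3 ℕ.+ j))) ⟩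
  t * (+ 2 * + (2 ^ (3 ℕ.+ j)))   ≡⟨ cong (t *_) (ℤₚ.pos-* 2 (2 ^ (3 ℕ.+ j))) ⟨
  t * + (2 ^ (4 ℕ.+ j))           ∎))
  where reassoc : ∀ t P → + 2 * t * P ≡ t * (+ 2 * P)
        reassoc = solve-∀
...   | odd t refl | f , refl =
  + 2 * f + + 1 + + 4 * + (2 ^ j) ,
  subst (λ i → Odd ∣ i ∣) (sym (regroup f (+ (2 ^ j)))) (2t+1-odd (f + + 2 * + (2 ^ j))) ,
  shifted-root-mod-2^ f t j e²-c≡D2³⁺ʲ
  where regroup : ∀ f G → + 2 * f + + 1 + + 4 * G ≡ + 2 * (f + + 2 * G) + + 1
        regroup = solve-∀

1-mod-8⇒square-mod-2^ : ∀ {c} → c ≡ + 1 mod 8 → ∀ k → ∃ λ e → e * e ≡ c mod 2 ^ k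
1-mod-8⇒square-mod-2^ c≡1 k = let e , _ , e²≡c = 1-mod-8⇒odd-square-mod-2^ c≡1 k in
  e , mod-weaken (ℕD.divides 8 (ℕₚ.^-distribˡ-+-* 2 3 k)) e²≡c

i-j≡k⇒i≡j+k : ∀ {i j k} → i - j ≡ k → i ≡ j + k
i-j≡k⇒i≡j+k {i} {j} refl = i≡j+[i-j] i j
  where i≡j+[i-j] : ∀ i j → i ≡ j + (i - j)
        i≡j+[i-j] = solve-∀

3-mod-4⇒R+1-square-mod-8 : ∀ {R t} → R - + 3 ≡ t * + 4 → ∃ λ e → e * e ≡ R + + 1 mod 8
3-mod-4⇒R+1-square-mod-8 {R} {t} R-3≡4t with parity t
... | even u refl = + 2 , congruent (divides (- u) (begin
  + 2 * + 2 - (R + + 1)                   ≡⟨ cong (λ x → + 2 * + 2 - (x + + 1)) (i-j≡k⇒i≡j+k {R} {+ 3} R-3≡4t) ⟩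
  + 2 * + 2 - (+ 3 + + 2 * u * + 4 + + 1) ≡⟨ even-case u ⟩
  - u * + 8                               ∎))
  where even-case : ∀ u → + 2 * + 2 - (+ 3 + + 2 * u * + 4 + + 1) ≡ - u * + 8
        even-case = solve-∀
... | odd u refl = + 0 , congruent (divides (- (u + + 1)) (begin
  + 0 * + 0 - (R + + 1)                           ≡⟨ cong (λ x → + 0 * + 0 - (x + + 1)) (i-j≡k⇒i≡j+k {R} {+ 3} R-3≡4t) ⟩
  + 0 * + 0 - (+ 3 + (+ 2 * u + + 1) * + 4 + + 1) ≡⟨ odd-case u ⟩
  - (u + + 1) * + 8                               ∎))
  where odd-case : ∀ u → + 0 * + 0 - (+ 3 + (+ 2 * u + + 1) * + 4 + + 1) ≡ - (u + + 1) * + 8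
        odd-case = solve-∀

R+[2GM₀]²≡1-mod-8 : ∀ {R G M₀ q s t} → R - (+ 4 * G + + 1) ≡ q * + 8 → M₀ * M₀ - + 1 ≡ s * + 8 →
                    t * + 2 ≡ G * (G + + 1) → R + + 2 * G * M₀ * (+ 2 * G * M₀) ≡ + 1 mod 8
R+[2GM₀]²≡1-mod-8 {R} {G} {M₀} {q} {s} {t} R≡ M₀²≡ t*2≡ = congruent (divides (q + + 4 * G * G * s + t) (begin
  R + + 2 * G * M₀ * (+ 2 * G * M₀) - + 1
    ≡⟨ regroup R G M₀ ⟩
  (R - (+ 4 * G + + 1)) + + 4 * (G * G) * (M₀ * M₀ - + 1) + + 4 * (G * (G + + 1))
    ≡⟨ cong₂ (λ a b → a + + 4 * (G * G) * b + + 4 * (G * (G + + 1))) R≡ M₀²≡ ⟩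
  q * + 8 + + 4 * (G * G) * (s * + 8) + + 4 * (G * (G + + 1))
    ≡⟨ cong (λ b → q * + 8 + + 4 * (G * G) * (s * + 8) + + 4 * b) t*2≡ ⟨
  q * + 8 + + 4 * (G * G) * (s * + 8) + + 4 * (t * + 2)
    ≡⟨ collect q G s t ⟩
  (q + + 4 * G * G * s + t) * + 8 ∎))
  where
  regroup : ∀ R G M₀ → R + + 2 * G * M₀ * (+ 2 * G * M₀) - + 1
            ≡ (R - (+ 4 * G + + 1)) + + 4 * (G * G) * (M₀ * M₀ - + 1) + + 4 * (G * (G + + 1))
  regroup = solve-∀
  collect : ∀ q G s t → q * + 8 + + 4 * (G * G) * (s * + 8) + + 4 * (t * + 2) ≡ (q + + 4 * G * G * s + t) * + 8
  collect = solve-∀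

two-adic-square : ∀ α {r m₀} → Odd m₀ → + (2 ^ ((suc α ℕ.+ 1) ⊓ 3)) ℤD.∣ + r - + (2 ^ suc α ℕ.+ 1) →
                  ∃ λ e → e * e ≡ + r + + (2 ^ α ℕ.* m₀) * + (2 ^ α ℕ.* m₀) mod 2 ^ (1 ℕ.+ (suc α ℕ.+ suc α))
two-adic-square zero {r} {m₀} m₀-odd 4∣r-3 =
  let divides t r-3≡4t = ∣ᵤ⇒∣ {+ 4} {+ r - + 3} 4∣r-3
      e , e²≡r+1 = 3-mod-4⇒R+1-square-mod-8 {+ r} {t} r-3≡4t
  in e , mod-trans e²≡r+1 (mod-+ˡ (+ r) (mod-sym m₀²≡1))
  where
  m₀²≡1 : + (1 ℕ.* m₀) * + (1 ℕ.* m₀) ≡ + 1 mod 8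
  m₀²≡1 = odd²≡1-mod-8 {+ (1 ℕ.* m₀)} (subst Odd (sym (ℕₚ.*-identityˡ m₀)) m₀-odd)
two-adic-square (suc i) {r} {m₀} m₀-odd 2^min∣r-2^α-1 =
  let divides q r≡ = ∣ᵤ⇒∣ {+ 8} {+ r - + (2 ^ (2 ℕ.+ i) ℕ.+ 1)} 8∣r-2^α-1
      congruent (divides s m₀²≡) = odd²≡1-mod-8 {+ m₀} m₀-odd
  in 1-mod-8⇒square-mod-2^
       (subst (λ h → + r + h * h ≡ + 1 mod 8) (sym +h≡)
         (R+[2GM₀]²≡1-mod-8 {+ r} {G} {+ m₀} {q} {s} {T G}
           (trans (cong (λ x → + r - x) (sym +2^[2+i]+1≡)) r≡) m₀²≡ (T*2≡x*[x+1] G)))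
       (1 ℕ.+ (2 ℕ.+ i ℕ.+ (2 ℕ.+ i)))
  where
  G : ℤ
  G = + (2 ^ i)
  8∣r-2^α-1 : + 8 ℤD.∣ + r - + (2 ^ (2 ℕ.+ i) ℕ.+ 1)
  8∣r-2^α-1 = subst (λ k → + (2 ^ k) ℤD.∣ + r - + (2 ^ (2 ℕ.+ i) ℕ.+ 1))
                    (ℕₚ.m≥n⇒m⊓n≡n {suc (suc i) ℕ.+ 1} {3} (s≤s (s≤s (ℕₚ.m≤n+m 1 i)))) 2^min∣r-2^α-1
  +2^[2+i]+1≡ : + (2 ^ (2 ℕ.+ i) ℕ.+ 1) ≡ + 4 * G + + 1
  +2^[2+i]+1≡ = cong (_+ + 1) (+2^[k+j]≡+2^k*+2^j 2 i)
  +h≡ : + (2 ^ suc i ℕ.* m₀) ≡ + 2 * G * + m₀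
  +h≡ = trans (ℤₚ.pos-* (2 ^ suc i) m₀) (cong (_* + m₀) (+2^[k+j]≡+2^k*+2^j 1 i))

-- Factorisations

factor-sum : ∀ D E a b .{{_ : NonZero a}} → ∣ D ∣ ≡ a → D * E ≡ + (a ℕ.* b) →
             D + E ≡ + (a ℕ.+ b) ⊎ D + E ≡ - + (a ℕ.+ b)
factor-sum D E a b ∣D∣≡a DE≡ab with ℤₚ.+∣i∣≡i⊎+∣i∣≡-i D
... | inj₁ +∣D∣≡D = inj₁ (cong₂ _+_ D≡a E≡b)
  where
  D≡a : D ≡ + a
  D≡a = trans (sym +∣D∣≡D) (cong +_ ∣D∣≡a)
  E≡b : E ≡ + b
  E≡b = ℤₚ.*-cancelˡ-≡ (+ a) E (+ b) (trans (cong (_* E) (sym D≡a)) (trans DE≡ab (ℤₚ.pos-* a b)))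
... | inj₂ +∣D∣≡-D = inj₂ (begin
  D + E           ≡⟨ cong₂ _+_ D≡-a E≡-b ⟩
  - + a + - + b   ≡⟨ ℤₚ.neg-distrib-+ (+ a) (+ b) ⟨
  - (+ a + + b)   ∎)
  where
  D≡-a : D ≡ - + a
  D≡-a = trans (sym (ℤₚ.neg-involutive D)) (cong -_ (trans (sym +∣D∣≡-D) (cong +_ ∣D∣≡a)))
  -E≡b : - E ≡ + b
  -E≡b = ℤₚ.*-cancelˡ-≡ (+ a) (- E) (+ b) (begin
    + a * - E     ≡⟨ ℤₚ.neg-distribʳ-* (+ a) E ⟨
    - (+ a * E)   ≡⟨ ℤₚ.neg-distribˡ-* (+ a) E ⟩
    - + a * E     ≡⟨ cong (_* E) D≡-a ⟨
    D * E         ≡⟨ DE≡ab ⟩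
    + (a ℕ.* b)   ≡⟨ ℤₚ.pos-* a b ⟩
    + a * + b     ∎)
  E≡-b : E ≡ - + b
  E≡-b = trans (sym (ℤₚ.neg-involutive E)) (cong -_ -E≡b)

positive-case : ∀ {i n} → + 0 ℤ.< i → i ≡ + suc n ⊎ i ≡ - + suc n → i ≡ + suc n
positive-case 0<i = [ id , (λ i≡-n → contradiction (subst (+ 0 ℤ.<_) i≡-n 0<i) λ ()) ]′

divisor-pair-sum : ∀ {p} c D E → Prime p → ∣ D ∣ ℕD.∣ p → D * E ≡ + (c ℕ.* p) → + 0 ℤ.< D + E →
                   D + E ≡ + (1 ℕ.+ c ℕ.* p) ⊎ D + E ≡ + (p ℕ.+ c)
divisor-pair-sum {zero}       c D E p-prime = contradiction p-prime ¬prime[0]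
divisor-pair-sum {p@(suc _)} c D E p-prime D∣p DE≡cp 0<D+E with prime⇒irreducible p-prime D∣p
... | inj₁ ∣D∣≡1 = inj₁ (positive-case 0<D+E
  (factor-sum D E 1 (c ℕ.* p) ∣D∣≡1 (trans DE≡cp (cong +_ (sym (ℕₚ.*-identityˡ (c ℕ.* p)))))))
... | inj₂ ∣D∣≡p = inj₂ (positive-case 0<D+E
  (factor-sum D E p c ∣D∣≡p (trans DE≡cp (cong +_ (ℕₚ.*-comm c p)))))

odd-factor-sum : ∀ {p} k D E → Prime p → Odd ∣ D ∣ → D * E ≡ + (2 ^ k ℕ.* p) → + 0 ℤ.< D + E →
                 D + E ≡ + (1 ℕ.+ 2 ^ k ℕ.* p) ⊎ D + E ≡ + (p ℕ.+ 2 ^ k)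
odd-factor-sum k D E p-prime D-odd DE≡ = divisor-pair-sum (2 ^ k) D E p-prime D∣p DE≡
  where
  D∣2^kp : ∣ D ∣ ℕD.∣ 2 ^ k ℕ.* _
  D∣2^kp = ℕD.divides ∣ E ∣ (trans (cong ∣_∣ (sym DE≡)) (trans (ℤₚ.abs-* D E) (ℕₚ.*-comm ∣ D ∣ ∣ E ∣)))
  D∣p : ∣ D ∣ ℕD.∣ _
  D∣p = coprime-divisor (Coprimality.sym (2^k⊥odd k D-odd)) D∣2^kp

odd-sum-factor-sum : ∀ {p} k D E → Prime p → Odd ∣ D + E ∣ → D * E ≡ + (2 ^ k ℕ.* p) → + 0 ℤ.< D + E →
                     D + E ≡ + (1 ℕ.+ 2 ^ k ℕ.* p) ⊎ D + E ≡ + (p ℕ.+ 2 ^ k)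
odd-sum-factor-sum k D E p-prime sum-odd DE≡ 0<D+E with parity D
... | odd t D≡ = odd-factor-sum k D E p-prime (subst (λ i → Odd ∣ i ∣) (sym D≡) (2t+1-odd t)) DE≡ 0<D+E
... | even t D≡ = let s , D+E≡ = odd⇒2t+1 {D + E} sum-odd in
  subst (λ x → x ≡ _ ⊎ x ≡ _) (ℤₚ.+-comm E D)
    (odd-factor-sum k E D p-prime (E-odd s D+E≡) (trans (ℤₚ.*-comm E D) DE≡)
      (subst (+ 0 ℤ.<_) (ℤₚ.+-comm D E) 0<D+E))
  where
  E-odd : ∀ s → D + E ≡ + 2 * s + + 1 → Odd ∣ E ∣
  E-odd s D+E≡ = subst (λ i → Odd ∣ i ∣) (sym E≡) (2t+1-odd (s - t))
    where
    E≡ : E ≡ + 2 * (s - t) + + 1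
    E≡ = begin
      E                          ≡⟨ via-sum D E ⟩
      (D + E) - D                ≡⟨ cong₂ _-_ D+E≡ D≡ ⟩
      + 2 * s + + 1 - + 2 * t    ≡⟨ regroup s t ⟩
      + 2 * (s - t) + + 1        ∎
      where
      via-sum : ∀ D E → E ≡ (D + E) - D
      via-sum = solve-∀
      regroup : ∀ s t → + 2 * s + + 1 - + 2 * t ≡ + 2 * (s - t) + + 1
      regroup = solve-∀

odd-square-difference : ∀ {z w p} k → Prime p → Odd ∣ z ∣ → Odd ∣ w ∣ →
                        (z - w) * (z + w) ≡ + 4 * + (2 ^ k ℕ.* p) → + 0 ℤ.< z →
                        z ≡ + (1 ℕ.+ 2 ^ k ℕ.* p) ⊎ z ≡ + (p ℕ.+ 2 ^ k)
odd-square-difference {z} {w} k p-prime z-odd w-odd z²-w²≡ 0<z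
  with odd⇒2t+1 {z} z-odd | odd⇒2t+1 {w} w-odd
... | z′ , refl | g , refl =
  subst (λ s → s ≡ _ ⊎ s ≡ _) D+E≡z
    (odd-sum-factor-sum k (z′ - g) (z′ + g + + 1) p-prime (subst (λ i → Odd ∣ i ∣) (sym D+E≡z) z-odd) DE≡
      (subst (+ 0 ℤ.<_) (sym D+E≡z) 0<z))
  where
  D+E≡z : (z′ - g) + (z′ + g + + 1) ≡ + 2 * z′ + + 1
  D+E≡z = split z′ g
    where split : ∀ z′ g → (z′ - g) + (z′ + g + + 1) ≡ + 2 * z′ + + 1
          split = solve-∀
  DE≡ : (z′ - g) * (z′ + g + + 1) ≡ + (2 ^ k ℕ.* _)
  DE≡ = ℤₚ.*-cancelˡ-≡ (+ 4) _ _ (trans (four-factors z′ g) z²-w²≡)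
    where four-factors : ∀ z′ g → + 4 * ((z′ - g) * (z′ + g + + 1))
                                  ≡ (+ 2 * z′ + + 1 - (+ 2 * g + + 1)) * (+ 2 * z′ + + 1 + (+ 2 * g + + 1))
          four-factors = solve-∀

-- With k L = 8h², the representation L n + R = C + L Tₓ turns z² = k R + h² + k L n into
-- z² − h²(2x+1)² = k C; part (i) uses k = 8, part (ii) k = 1.
representation⇒factorisation : ∀ {z h x t n R C k L} → k * L ≡ + 8 * (h * h) → t * + 2 ≡ x * (x + + 1) →
  z * z ≡ k * R + h * h + k * L * n → L * n + R ≡ C + L * t →
  (z - h * (+ 2 * x + + 1)) * (z + h * (+ 2 * x + + 1)) ≡ k * C
representation⇒factorisation {z} {h} {x} {t} {n} {R} {C} {k} {L} kL≡8h² t*2≡ z²≡ Ln+R≡ = begin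
  (z - h * (+ 2 * x + + 1)) * (z + h * (+ 2 * x + + 1))
    ≡⟨ expand z h x ⟩
  z * z - h * h - + 4 * (h * h) * (x * (x + + 1))
    ≡⟨ cong₂ (λ a b → a - h * h - + 4 * (h * h) * b) z²≡ (sym t*2≡) ⟩
  k * R + h * h + k * L * n - h * h - + 4 * (h * h) * (t * + 2)
    ≡⟨ regroup k R h L n t ⟩
  k * (L * n + R) - + 8 * (h * h) * t
    ≡⟨ cong₂ (λ a b → k * a - b * t) Ln+R≡ (sym kL≡8h²) ⟩
  k * (C + L * t) - k * L * t
    ≡⟨ cancel k C L t ⟩
  k * C ∎
  where
  expand : ∀ z h x → (z - h * (+ 2 * x + + 1)) * (z + h * (+ 2 * x + + 1))
                     ≡ z * z - h * h - + 4 * (h * h) * (x * (x + + 1))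
  expand = solve-∀
  regroup : ∀ k R h L n t → k * R + h * h + k * L * n - h * h - + 4 * (h * h) * (t * + 2)
                            ≡ k * (L * n + R) - + 8 * (h * h) * t
  regroup = solve-∀
  cancel : ∀ k C L t → k * (C + L * t) - k * L * t ≡ k * C
  cancel = solve-∀

-- Infinitely many excluded integers

infinitely-many-quotients : ∀ {K L c} B₀ {P : ℕ → Set} .{{_ : NonZero K}} .{{_ : NonZero L}} w →
  K ℕD.∣ L → w * w ≡ + c mod K →
  (∀ z n → B₀ ℕ.< z → + z ≡ w mod L → + z * + z ≡ + c + + K * + n → P n) →
  InfinitelyMany (λ n → 0 ℕ.< n × P n)
infinitely-many-quotients {K} {L} {c} B₀ {P} w K∣L w²≡c excluded N =
  let z , B≤z , z≡w = large-representative {L} w (suc B₀ ℕ.+ bound)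
      n , N<n , z²≡c+Kn = quotient-large {K} {c} {z} N (ℕₚ.≤-trans (ℕₚ.m≤n+m bound (suc B₀)) B≤z)
                                          (mod-trans (mod-square (mod-weaken K∣L z≡w)) w²≡c)
  in n , N<n , ℕₚ.≤-<-trans z≤n N<n ,
     excluded z n (ℕₚ.≤-trans (ℕₚ.m≤m+n (suc B₀) bound) B≤z) z≡w (lift-to-ℤ z n z²≡c+Kn)
  where
  bound : ℕ
  bound = c ℕ.+ K ℕ.* suc N
  lift-to-ℤ : ∀ z n → z ℕ.* z ≡ c ℕ.+ K ℕ.* n → + z * + z ≡ + c + + K * + n
  lift-to-ℤ z n z²≡c+Kn = begin
    + z * + z         ≡⟨ ℤₚ.pos-* z z ⟨
    + (z ℕ.* z)       ≡⟨ cong +_ z²≡c+Kn ⟩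
    + c + + (K ℕ.* n) ≡⟨ cong (λ t → + c + t) (ℤₚ.pos-* K n) ⟩
    + c + + K * + n   ∎

excluded⇒InS-infinite : ∀ {a M r} .{{_ : NonZero M}} → 0 ℕ.< r → Coprime M r →
  InfinitelyMany (λ n → 0 ℕ.< n × ¬ OfForm (2 ^ a) M r n) → InfinitelyMany (InS a M)
excluded⇒InS-infinite {a} {M} {r} 0<r M⊥r excluded N =
  let n , N<n , 0<n , ¬form = excluded N
  in M ℕ.* n ℕ.+ r ,
     ℕₚ.<-≤-trans N<n (ℕₚ.≤-trans (ℕₚ.m≤n*m n M) (ℕₚ.m≤m+n _ r)) ,
     ℕₚ.≤-<-trans (subst (ℕ._≤ M ℕ.* n) (ℕₚ.*-identityʳ M) (ℕₚ.*-monoʳ-≤ M 0<n)) (ℕₚ.m<m+n (M ℕ.* n) 0<r) ,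
     (λ (i∣M , i∣Mn+r) → M⊥r (i∣M , ℕD.∣m+n∣m⇒∣n i∣Mn+r (ℕD.∣m⇒∣m*n n i∣M))) ,
     ¬form

-- Part (i)

module Part1 (m a r : ℕ) (1<m : 1 ℕ.< m) (m-odd : Odd m) (qr : QuadRes m (+ (2 ℕ.* r))) where

  K c E q₁ q₂ L : ℕ
  K  = 8 ℕ.* (m ℕ.* m)
  c  = 8 ℕ.* r ℕ.+ m ℕ.* m
  E  = 2 ^ suc a
  q₁ = suc K
  q₂ = suc (K ℕ.* q₁)
  L  = K ℕ.* q₁ ℕ.* q₂

  instance
    m≢0 : NonZero m
    m≢0 = ℕ.>-nonZero (ℕₚ.<-trans (s≤s z≤n) 1<m)
    m²≢0 : NonZero (m ℕ.* m)
    m²≢0 = ℕₚ.m*n≢0 m m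
    K≢0 : NonZero K
    K≢0 = ℕₚ.m*n≢0 8 (m ℕ.* m)
    Kq₁≢0 : NonZero (K ℕ.* q₁)
    Kq₁≢0 = ℕₚ.m*n≢0 K q₁
    L≢0 : NonZero L
    L≢0 = ℕₚ.m*n≢0 (K ℕ.* q₁) q₂

  +c≡ : + c ≡ + 8 * + r + + m * + m
  +c≡ = cong₂ _+_ (ℤₚ.pos-* 8 r) (ℤₚ.pos-* m m)

  +K≡ : + K ≡ + 8 * (+ m * + m)
  +K≡ = trans (ℤₚ.pos-* 8 (m ℕ.* m)) (cong (+ 8 *_) (ℤₚ.pos-* m m))

  2∣K : 2 ℕD.∣ K
  2∣K = ℕD.∣m⇒∣m*n (m ℕ.* m) (ℕD.divides 4 refl)

  K∣L : K ℕD.∣ L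
  K∣L = ℕD.∣m⇒∣m*n q₂ (ℕD.m∣m*n q₁)

  q₁-odd : Odd q₁
  q₁-odd 2∣q₁ = contradiction (ℕD.∣1⇒≡1 (ℕD.∣m+n∣m⇒∣n (subst (2 ℕD.∣_) (ℕₚ.+-comm 1 K) 2∣q₁) 2∣K)) λ ()

  c≡1-mod-8 : + c ≡ + 1 mod 8
  c≡1-mod-8 = mod-trans (congruent (divides (+ r) c-m²≡8r)) (odd²≡1-mod-8 {+ m} m-odd)
    where
    c-m²≡8r : + c - + m * + m ≡ + r * + 8
    c-m²≡8r = trans (cong (_- + m * + m) +c≡) (cancel (+ r) (+ m * + m))
      where cancel : ∀ r M → + 8 * r + M - M ≡ r * + 8
            cancel = solve-∀

  double-root : ∀ {w} → w * w ≡ + (2 ℕ.* r) mod m ℕ.* m → + 2 * w * (+ 2 * w) ≡ + c mod m ℕ.* m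
  double-root {w} (congruent (divides q w²-2r≡qm²)) = congruent (divides (+ 4 * q - + 1) (begin
    + 2 * w * (+ 2 * w) - + c                       ≡⟨ cong (λ t → + 2 * w * (+ 2 * w) - t) +c≡4[2r]+m² ⟩
    + 2 * w * (+ 2 * w) - (+ 4 * + (2 ℕ.* r) + M)   ≡⟨ regroup w (+ (2 ℕ.* r)) M ⟩
    + 4 * (w * w - + (2 ℕ.* r)) - M                 ≡⟨ cong (λ t → + 4 * t - M) w²-2r≡qm² ⟩
    + 4 * (q * M) - M                               ≡⟨ collect q M ⟩
    (+ 4 * q - + 1) * M                             ∎))
    where
    M = + (m ℕ.* m)
    +c≡4[2r]+m² : + c ≡ + 4 * + (2 ℕ.* r) + M
    +c≡4[2r]+m² = cong (_+ M) (trans (cong +_ (ℕₚ.*-assoc 4 2 r)) (ℤₚ.pos-* 4 (2 ℕ.* r)))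
    regroup : ∀ w R M → + 2 * w * (+ 2 * w) - (+ 4 * R + M) ≡ + 4 * (w * w - R) - M
    regroup = solve-∀
    collect : ∀ q M → + 4 * (q * M) - M ≡ (+ 4 * q - + 1) * M
    collect = solve-∀

  8⊥m² : Coprime 8 (m ℕ.* m)
  8⊥m² = 2^k⊥odd 3 (odd-* m-odd m-odd)

  root-mod-K : ∃ λ z₀ → Odd ∣ z₀ ∣ × z₀ * z₀ ≡ + c mod K
  root-mod-K =
    let w , w²≡2r = quadRes⇒square-mod-square m-odd qr
        z₀ , z₀≡1 , z₀≡2w = crt 8⊥m² (+ 1) (+ 2 * w)
    in z₀ , odd-resp-mod (ℕD.divides 4 refl) z₀≡1 (2t+1-odd (+ 0)) ,
       mod-combine 8⊥m² (mod-trans (mod-square z₀≡1) (mod-sym c≡1-mod-8))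
                        (mod-trans (mod-square z₀≡2w) (double-root {w} w²≡2r))

  -- Modulo q₁ and q₂ these congruences leave z = 1 + E q₁ and z = q₂ + E as the only
  -- instances of z = 1 + E p and z = p + E.
  residue-class : ∃ λ w → Odd ∣ w ∣ × w * w ≡ + c mod K × w ≡ + 1 mod q₁ × w ≡ + E mod q₂
  residue-class =
    let z₀ , z₀-odd , z₀²≡c = root-mod-K
        w₁ , w₁≡z₀ , w₁≡1 = crt (n⊥1+n K) z₀ (+ 1)
        w , w≡w₁ , w≡E = crt (n⊥1+n (K ℕ.* q₁)) w₁ (+ E)
        w≡z₀ = mod-trans (mod-weaken (ℕD.m∣m*n q₁) w≡w₁) w₁≡z₀
    in w , odd-resp-mod 2∣K w≡z₀ z₀-odd , mod-trans (mod-square w≡z₀) z₀²≡c ,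
       mod-trans (mod-weaken (ℕD.n∣m*n K) w≡w₁) w₁≡1 , w≡E

  representation⇒z≡ : ∀ {z n p x} → Prime p → Odd z → + z * + z ≡ + c + + K * + n →
                      + (m ℕ.* m ℕ.* n) + + r ≡ + (2 ^ a ℕ.* p) + + (m ℕ.* m) * T x → 0 ℕ.< z →
                      + z ≡ + (1 ℕ.+ E ℕ.* p) ⊎ + z ≡ + (p ℕ.+ E)
  representation⇒z≡ {z} {n} {p} {x} p-prime z-odd z²≡c+Kn rep 0<z =
    odd-square-difference {w = + m * (+ 2 * x + + 1)} (suc a) p-prime z-odd hs-odd
      (trans (representation⇒factorisation {+ z} {+ m} {x} {T x} {+ n} {+ r} {+ (2 ^ a ℕ.* p)} {+ 8} {+ m * + m}
               refl (T*2≡x*[x+1] x) z²≡ rep′)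
             8C≡4C′)
      (+<+ 0<z)
    where
    hs-odd : Odd ∣ + m * (+ 2 * x + + 1) ∣
    hs-odd = subst Odd (sym (ℤₚ.abs-* (+ m) (+ 2 * x + + 1))) (odd-* m-odd (2t+1-odd x))
    z²≡ : + z * + z ≡ + 8 * + r + + m * + m + + 8 * (+ m * + m) * + n
    z²≡ = trans z²≡c+Kn (cong₂ (λ s t → s + t * + n) +c≡ +K≡)
    rep′ : + m * + m * + n + + r ≡ + (2 ^ a ℕ.* p) + + m * + m * T x
    rep′ = begin
      + m * + m * + n + + r               ≡⟨ cong (λ t → t * + n + + r) (ℤₚ.pos-* m m) ⟨
      + (m ℕ.* m) * + n + + r             ≡⟨ cong (_+ + r) (ℤₚ.pos-* (m ℕ.* m) n) ⟨
      + (m ℕ.* m ℕ.* n) + + r             ≡⟨ rep ⟩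
      + (2 ^ a ℕ.* p) + + (m ℕ.* m) * T x ≡⟨ cong (λ t → + (2 ^ a ℕ.* p) + t * T x) (ℤₚ.pos-* m m) ⟩
      + (2 ^ a ℕ.* p) + + m * + m * T x   ∎
    8C≡4C′ : + 8 * + (2 ^ a ℕ.* p) ≡ + 4 * + (2 ^ suc a ℕ.* p)
    8C≡4C′ = begin
      + 8 * + (2 ^ a ℕ.* p)            ≡⟨ ℤₚ.pos-* 8 (2 ^ a ℕ.* p) ⟨
      + (8 ℕ.* (2 ^ a ℕ.* p))          ≡⟨ cong +_ (ℕₚ.*-assoc 4 2 (2 ^ a ℕ.* p)) ⟩
      + (4 ℕ.* (2 ℕ.* (2 ^ a ℕ.* p)))  ≡⟨ cong (λ t → + (4 ℕ.* t)) (ℕₚ.*-assoc 2 (2 ^ a) p) ⟨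
      + (4 ℕ.* (2 ^ suc a ℕ.* p))      ≡⟨ ℤₚ.pos-* 4 (2 ^ suc a ℕ.* p) ⟩
      + 4 * + (2 ^ suc a ℕ.* p)        ∎

  B₀ : ℕ
  B₀ = suc (E ℕ.* q₁) ℕ.+ (q₂ ℕ.+ E)

  excluded : ∀ {w} → Odd ∣ w ∣ → w ≡ + 1 mod q₁ → w ≡ + E mod q₂ →
             ∀ z n → B₀ ℕ.< z → + z ≡ w mod L → + z * + z ≡ + c + + K * + n →
             ¬ OfForm (2 ^ a) (m ℕ.* m) r n
  excluded w-odd w≡1 w≡E z n B₀<z z≡w z²≡c+Kn (p , p-prime , x , rep) =
    [ z≢1+Ep , z≢p+E ]′
      (representation⇒z≡ {x = x} p-prime (odd-resp-mod (ℕD.∣-trans 2∣K K∣L) z≡w w-odd) z²≡c+Kn rep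
        (ℕₚ.≤-<-trans z≤n B₀<z))
    where
    z≢1+Ep : + z ≢ + (1 ℕ.+ E ℕ.* p)
    z≢1+Ep +z≡1+Ep = ℕₚ.<⇒≱ B₀<z (subst (ℕ._≤ B₀) (sym z≡1+Eq₁) (ℕₚ.m≤m+n (suc (E ℕ.* q₁)) (q₂ ℕ.+ E)))
      where
      q₁∣Ep : q₁ ℕD.∣ E ℕ.* p
      q₁∣Ep = +-mod⇒∣ (subst (λ t → + t ≡ + 1 mod q₁) (trans (ℤₚ.+-injective +z≡1+Ep) (ℕₚ.+-comm 1 _))
                             (mod-trans (mod-weaken (ℕD.∣m⇒∣m*n q₂ (ℕD.n∣m*n K)) z≡w) w≡1))
      q₁≡p : q₁ ≡ p
      q₁≡p = ∣prime⇒≡ p-prime (s≤s (ℕ.>-nonZero⁻¹ K))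
               (coprime-divisor (Coprimality.sym (2^k⊥odd (suc a) q₁-odd)) q₁∣Ep)
      z≡1+Eq₁ : z ≡ suc (E ℕ.* q₁)
      z≡1+Eq₁ = trans (ℤₚ.+-injective +z≡1+Ep) (cong (λ t → suc (E ℕ.* t)) (sym q₁≡p))
    z≢p+E : + z ≢ + (p ℕ.+ E)
    z≢p+E +z≡p+E = ℕₚ.<⇒≱ B₀<z (subst (ℕ._≤ B₀) (sym z≡q₂+E) (ℕₚ.m≤n+m (q₂ ℕ.+ E) (suc (E ℕ.* q₁))))
      where
      q₂∣p : q₂ ℕD.∣ p
      q₂∣p = +-mod⇒∣ (subst (λ t → + t ≡ + E mod q₂) (ℤₚ.+-injective +z≡p+E)
                            (mod-trans (mod-weaken (ℕD.n∣m*n (K ℕ.* q₁)) z≡w) w≡E))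
      z≡q₂+E : z ≡ q₂ ℕ.+ E
      z≡q₂+E = trans (ℤₚ.+-injective +z≡p+E)
                     (cong (ℕ._+ E) (sym (∣prime⇒≡ p-prime (s≤s (ℕ.>-nonZero⁻¹ (K ℕ.* q₁))) q₂∣p)))

  m²⊥r : Coprime (m ℕ.* m) r
  m²⊥r = coprime-* m⊥r m⊥r
    where m⊥r : Coprime m r
          m⊥r (i∣m , i∣r) = quadRes⇒coprime {R = + (2 ℕ.* r)} qr (i∣m , ℕD.∣n⇒∣m*n 2 i∣r)

  infinitely-many-excluded : InfinitelyMany (λ n → 0 ℕ.< n × ¬ OfForm (2 ^ a) (m ℕ.* m) r n)
  infinitely-many-excluded =
    let w , w-odd , w²≡c , w≡1 , w≡E = residue-class
    in infinitely-many-quotients B₀ w K∣L w²≡c (excluded w-odd w≡1 w≡E)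

part1 : Part1
part1 m 1<m m-odd a r 0<r qr =
  infinitely-many-excluded , excluded⇒InS-infinite {a} 0<r m²⊥r infinitely-many-excluded
  where open Part1 m a r 1<m m-odd qr

-- Part (ii)

-- α is one less than the exponent α of the statement: m = 2^(α+1) m₀ and h = m / 2.
module Part2 (α m₀ r : ℕ) (0<m₀ : 0 ℕ.< m₀) (m₀-odd : Odd m₀) (qr : QuadRes m₀ (+ r))
             (r≡2^α+1 : + (2 ^ ((suc α ℕ.+ 1) ⊓ 3)) ℤD.∣ + r - + (2 ^ suc α ℕ.+ 1)) where

  m h M c q L P : ℕ
  m = 2 ^ suc α ℕ.* m₀
  h = 2 ^ α ℕ.* m₀
  M = 2 ℕ.* (m ℕ.* m)
  c = r ℕ.+ h ℕ.* h
  q = suc M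
  L = M ℕ.* q
  P = 2 ^ (1 ℕ.+ (suc α ℕ.+ suc α))

  instance
    m₀≢0 : NonZero m₀
    m₀≢0 = ℕ.>-nonZero 0<m₀
    2^α≢0 : NonZero (2 ^ suc α)
    2^α≢0 = ℕₚ.m^n≢0 2 (suc α)
    m≢0 : NonZero m
    m≢0 = ℕₚ.m*n≢0 (2 ^ suc α) m₀
    m²≢0 : NonZero (m ℕ.* m)
    m²≢0 = ℕₚ.m*n≢0 m m
    M≢0 : NonZero M
    M≢0 = ℕₚ.m*n≢0 2 (m ℕ.* m)
    L≢0 : NonZero L
    L≢0 = ℕₚ.m*n≢0 M q

  M≡8h² : M ≡ 8 ℕ.* (h ℕ.* h)
  M≡8h² = regroup (2 ^ α) m₀
    where regroup : ∀ X m₀ → 2 ℕ.* ((2 ℕ.* X ℕ.* m₀) ℕ.* (2 ℕ.* X ℕ.* m₀)) ≡ 8 ℕ.* ((X ℕ.* m₀) ℕ.* (X ℕ.* m₀))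
          regroup = ℕSolver.solve-∀

  Pm₀²≡M : P ℕ.* (m₀ ℕ.* m₀) ≡ M
  Pm₀²≡M = trans (cong (λ t → 2 ℕ.* t ℕ.* (m₀ ℕ.* m₀)) (ℕₚ.^-distribˡ-+-* 2 (suc α) (suc α)))
                 (regroup (2 ^ suc α) m₀)
    where regroup : ∀ X m₀ → 2 ℕ.* (X ℕ.* X) ℕ.* (m₀ ℕ.* m₀) ≡ 2 ℕ.* ((X ℕ.* m₀) ℕ.* (X ℕ.* m₀))
          regroup = ℕSolver.solve-∀

  r-odd : Odd r
  r-odd = odd-resp-mod {+ r} {+ (2 ^ suc α ℕ.+ 1)} (ℕD.m∣m*n (2 ^ ((α ℕ.+ 1) ⊓ 2)))
            (congruent (∣ᵤ⇒∣ {_} {+ r - + (2 ^ suc α ℕ.+ 1)} r≡2^α+1))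
            (subst (λ t → Odd ∣ t + + 1 ∣) (sym (ℤₚ.pos-* 2 (2 ^ α))) (2t+1-odd (+ (2 ^ α))))

  M⊥r : Coprime M r
  M⊥r = coprime-* (2⊥odd r-odd) (coprime-* m⊥r m⊥r)
    where m⊥r : Coprime m r
          m⊥r = coprime-* (2^k⊥odd (suc α) r-odd) (quadRes⇒coprime {R = + r} qr)

  +c≡ : + c ≡ + r + + h * + h
  +c≡ = cong (λ t → + r + t) (ℤₚ.pos-* h h)

  r≡c-mod-m₀² : + r ≡ + c mod m₀ ℕ.* m₀
  r≡c-mod-m₀² = congruent (divides (- X) (begin
    + r - (+ r + + (h ℕ.* h))   ≡⟨ cong (λ t → + r - (+ r + t)) +h²≡XY ⟩
    + r - (+ r + X * Y)         ≡⟨ cancel (+ r) X Y ⟩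
    - X * Y                     ∎))
    where
    X = + (2 ^ α ℕ.* 2 ^ α)
    Y = + (m₀ ℕ.* m₀)
    +h²≡XY : + (h ℕ.* h) ≡ X * Y
    +h²≡XY = trans (cong +_ (regroup (2 ^ α) m₀)) (ℤₚ.pos-* (2 ^ α ℕ.* 2 ^ α) (m₀ ℕ.* m₀))
      where regroup : ∀ G m₀ → (G ℕ.* m₀) ℕ.* (G ℕ.* m₀) ≡ (G ℕ.* G) ℕ.* (m₀ ℕ.* m₀)
            regroup = ℕSolver.solve-∀
    cancel : ∀ r X Y → r - (r + X * Y) ≡ - X * Y
    cancel = solve-∀

  P⊥m₀² : Coprime P (m₀ ℕ.* m₀)
  P⊥m₀² = 2^k⊥odd (1 ℕ.+ (suc α ℕ.+ suc α)) (odd-* m₀-odd m₀-odd)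

  root-mod-M : ∃ λ z₀ → z₀ * z₀ ≡ + c mod M
  root-mod-M =
    let e , e²≡r+h² = two-adic-square α m₀-odd r≡2^α+1
        w , w²≡r = quadRes⇒square-mod-square m₀-odd qr
        z₀ , z₀≡e , z₀≡w = crt P⊥m₀² e w
    in z₀ , subst (z₀ * z₀ ≡ + c mod_) Pm₀²≡M
              (mod-combine P⊥m₀² (mod-trans (mod-square z₀≡e) (subst (e * e ≡_mod P) (sym +c≡) e²≡r+h²))
                                 (mod-trans (mod-square z₀≡w) (mod-trans w²≡r r≡c-mod-m₀²)))

  B₀ : ℕ
  B₀ = suc (m ℕ.* m)

  residue-class : ∃ λ w → w * w ≡ + c mod M × w ≡ + B₀ mod q
  residue-class =
    let z₀ , z₀²≡c = root-mod-M
        w , w≡z₀ , w≡B₀ = crt (n⊥1+n M) z₀ (+ B₀)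
    in w , mod-trans (mod-square w≡z₀) z₀²≡c , w≡B₀

  2B₀≡1 : + 2 * + B₀ ≡ + 1 mod q
  2B₀≡1 = congruent (divides (+ 1) (begin
    + 2 * (+ 1 + X) - + 1        ≡⟨ regroup X ⟩
    + 1 * (+ 1 + + 2 * X)        ≡⟨ cong (λ t → + 1 * (+ 1 + t)) (ℤₚ.pos-* 2 (m ℕ.* m)) ⟨
    + 1 * + q                    ∎))
    where
    X = + (m ℕ.* m)
    regroup : ∀ X → + 2 * (+ 1 + X) - + 1 ≡ + 1 * (+ 1 + + 2 * X)
    regroup = solve-∀

  representation⇒2z≡p+1 : ∀ {z n p x} → Prime p → + z * + z ≡ + c + + M * + n →
                          + (M ℕ.* n) + + r ≡ + (1 ℕ.* p) + + M * T x → 0 ℕ.< z → 2 ℕ.* z ≡ p ℕ.+ 1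
  representation⇒2z≡p+1 {z} {n} {p} {x} p-prime z²≡c+Mn rep 0<z =
    [ (λ sum≡ → trans (ℤₚ.+-injective (trans 2z≡D+E sum≡)) (trans (cong suc (ℕₚ.*-identityˡ p)) (ℕₚ.+-comm 1 p)))
    , (λ sum≡ → ℤₚ.+-injective (trans 2z≡D+E sum≡)) ]′
      (divisor-pair-sum 1 D E p-prime D∣p DE≡p
        (subst (+ 0 ℤ.<_) 2z≡D+E (+<+ (ℕₚ.<-≤-trans 0<z (ℕₚ.m≤n*m z 2)))))
    where
    s D E : ℤ
    s = + 2 * x + + 1
    D = + z - + h * s
    E = + z + + h * s
    z²≡ : + z * + z ≡ + 1 * + r + + h * + h + + 1 * + M * + n
    z²≡ = trans z²≡c+Mn (trans (cong (_+ + M * + n) +c≡) (insert-ones (+ r) (+ h) (+ M) (+ n)))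
      where insert-ones : ∀ r h M n → r + h * h + M * n ≡ + 1 * r + h * h + + 1 * M * n
            insert-ones = solve-∀
    +M≡8h² : + 1 * + M ≡ + 8 * (+ h * + h)
    +M≡8h² = trans (ℤₚ.*-identityˡ (+ M))
               (trans (cong +_ M≡8h²) (trans (ℤₚ.pos-* 8 (h ℕ.* h)) (cong (+ 8 *_) (ℤₚ.pos-* h h))))
    DE≡p : D * E ≡ + (1 ℕ.* p)
    DE≡p = trans (representation⇒factorisation {+ z} {+ h} {x} {T x} {+ n} {+ r} {+ (1 ℕ.* p)} {+ 1} {+ M}
                   +M≡8h² (T*2≡x*[x+1] x) z²≡ (trans (cong (_+ + r) (sym (ℤₚ.pos-* M n))) rep))
                 (ℤₚ.*-identityˡ _)
    D∣p : ∣ D ∣ ℕD.∣ p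
    D∣p = ℕD.divides ∣ E ∣
      (trans (sym (ℕₚ.*-identityˡ p)) (trans (cong ∣_∣ (sym DE≡p)) (trans (ℤₚ.abs-* D E) (ℕₚ.*-comm ∣ D ∣ ∣ E ∣))))
    2z≡D+E : + (2 ℕ.* z) ≡ D + E
    2z≡D+E = trans (ℤₚ.pos-* 2 z) (split (+ z) (+ h * s))
      where split : ∀ z t → + 2 * z ≡ (z - t) + (z + t)
            split = solve-∀

  excluded : ∀ {w} → w ≡ + B₀ mod q →
             ∀ z n → B₀ ℕ.< z → + z ≡ w mod L → + z * + z ≡ + c + + M * + n → ¬ OfForm 1 M r n
  excluded w≡B₀ z n B₀<z z≡w z²≡c+Mn (p , p-prime , x , rep) = ℕₚ.<-irrefl (sym z≡B₀) B₀<z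
    where
    2z≡p+1 : 2 ℕ.* z ≡ p ℕ.+ 1
    2z≡p+1 = representation⇒2z≡p+1 {x = x} p-prime z²≡c+Mn rep (ℕₚ.≤-<-trans z≤n B₀<z)
    q≡p : q ≡ p
    q≡p = ∣prime⇒≡ p-prime (s≤s (ℕ.>-nonZero⁻¹ M)) (+-mod⇒∣ {p} {1}
            (subst (λ t → + t ≡ + 1 mod q) 2z≡p+1
              (subst (_≡ + 1 mod q) (sym (ℤₚ.pos-* 2 z))
                (mod-trans (mod-*ˡ (+ 2) (mod-trans (mod-weaken (ℕD.n∣m*n M) z≡w) w≡B₀)) 2B₀≡1))))
    z≡B₀ : z ≡ B₀
    z≡B₀ = ℕₚ.*-cancelˡ-≡ z B₀ 2 (trans 2z≡p+1 (trans (cong (ℕ._+ 1) (sym q≡p)) (double-suc (m ℕ.* m))))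
      where double-suc : ∀ x → suc (2 ℕ.* x) ℕ.+ 1 ≡ 2 ℕ.* suc x
            double-suc = ℕSolver.solve-∀

  infinitely-many-excluded : InfinitelyMany (λ n → 0 ℕ.< n × ¬ OfForm 1 M r n)
  infinitely-many-excluded =
    let w , w²≡c , w≡B₀ = residue-class
    in infinitely-many-quotients B₀ w (ℕD.m∣m*n q) w²≡c (excluded w≡B₀)

part2 : Part2
part2 zero    m₀ ()
part2 (suc α) m₀ _ 0<m₀ m₀-odd r 0<r qr r≡2^α+1 =
  infinitely-many-excluded , excluded⇒InS-infinite {0} 0<r M⊥r infinitely-many-excluded
  where open Part2 α m₀ r 0<m₀ m₀-odd qr r≡2^α+1


theorem1p2 : Part1 × Part2
theorem1p2 = part1 , part2
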